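{- Consider a $(t,k)$-coloring of $K_n$ which is interval (respectively chordal, respectively induced-$C_4$-free), and assume it has a strong cover with $\theta(K_n)=s$. Let $K_m$ be obtained from it by a clique substitution. Then the resulting coloring of $K_m$ is an interval (respectively chordal, respectively induced-$C_4$-free) $(t,k)$-coloring, and $\theta(K_m)=s$.
   Context: A $t$-coloring of $K_n$ is a representation of its edge set as a union $E(G_1)\cup\dots\cup E(G_t)$ of edge sets of $t$ graphs $G_1,\dots,G_t$ on $V(K_n)$; an edge may receive several colors (it has color $i$ if it is an edge of $G_i$), and every edge has at least one color. A clique of color $i$ (monochromatic clique) is a vertex set spanning a complete subgraph of $G_i$. A $(t,k)$-coloring is a $t$-coloring in which every set of $k$ vertices (the whole vertex set if $n<k$) spans a monochromatic clique in some color. The coloring is interval (resp. chordal, resp. induced-$C_4$-free) if every $G_i$ is an interval graph (resp. a chordal graph, i.e. has no induced cycle of length at least $4$; resp. has no induced cycle of length $4$). A strong cover is a covering of all vertices by monochromatic cliques whose colors are pairwise different; if a strong cover exists, $\theta(K_n)$ denotes the minimum number of cliques in a strong cover. A clique substitution replaces a vertex $v$ by a clique $K$ (on new vertices, together with $v$) all of whose edges receive all $t$ colors, and every edge between a vertex of $K$ and a vertex $u\notin K$ receives exactly the colors of the edge $uv$. -}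

module Defs where

open import Data.Nat using (ℕ; zero; suc; _≤_; _⊓_; _+_)
open import Data.Fin using (Fin; toℕ; splitAt; _≟_)
open import Data.Fin.Subset using (Subset; _∈_; ∣_∣)
open import Data.Product using (Σ; ∃; _×_)
open import Data.Sum using (_⊎_; inj₁; inj₂)
open import Data.Unit using (⊤)
open import Relation.Nullary using (¬_; yes; no)
open import Relation.Binary.PropositionalEquality using (_≡_; _≢_)
open import Function.Definitions using (Injective)

-- A (simple) graph on vertex set Fin n, given by an adjacency relation.
-- Only the values on pairs of distinct vertices are meaningful.
Graph : ℕ → Set₁
Graph n = Fin n → Fin n → Set

Coloring : ℕ → ℕ → Set₁
Coloring t n = Fin t → Graph n

_↔_ : Set → Set → Set
A ↔ B = (A → B) × (B → A)

IsTColoring : ∀ {t n} → Coloring t n → Set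
IsTColoring {t} {n} G =
  (∀ (i : Fin t) (u v : Fin n) → G i u v → G i v u) ×
  (∀ (u v : Fin n) → u ≢ v → ∃ λ (i : Fin t) → G i u v)

IsClique : ∀ {n} → Graph n → Subset n → Set
IsClique {n} H S = ∀ (u v : Fin n) → u ∈ S → v ∈ S → u ≢ v → H u v

IsTKColoring : ∀ {t n} → ℕ → Coloring t n → Set
IsTKColoring {t} {n} k G =
  IsTColoring G ×
  (∀ (S : Subset n) → ∣ S ∣ ≡ k ⊓ n → ∃ λ (i : Fin t) → IsClique (G i) S)

IsInterval : ∀ {n} → Graph n → Set
IsInterval {n} H =
  Σ (Fin n → ℕ) λ l → Σ (Fin n → ℕ) λ r →
    (∀ u → l u ≤ r u) ×
    (∀ (u v : Fin n) → u ≢ v → H u v ↔ (l u ≤ r v × l v ≤ r u))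

CycConsec : (k : ℕ) → Fin k → Fin k → Set
CycConsec k i j =
  (suc (toℕ i) ≡ toℕ j) ⊎ (suc (toℕ j) ≡ toℕ i) ⊎
  ((toℕ i ≡ 0 × suc (toℕ j) ≡ k) ⊎ (toℕ j ≡ 0 × suc (toℕ i) ≡ k))

InducedCycle : ∀ {n} → Graph n → (k : ℕ) → Set
InducedCycle {n} H k =
  Σ (Fin k → Fin n) λ f →
    Injective _≡_ _≡_ f ×
    (∀ (i j : Fin k) → i ≢ j → H (f i) (f j) ↔ CycConsec k i j)

IsChordal : ∀ {n} → Graph n → Set
IsChordal H = ∀ k → 4 ≤ k → ¬ InducedCycle H k

IsC4Free : ∀ {n} → Graph n → Set
IsC4Free H = ¬ InducedCycle H 4

data GraphClass : Set where
  interval chordal inducedC4free : GraphClass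

HasClass : GraphClass → ∀ {n} → Graph n → Set
HasClass interval      H = IsInterval H
HasClass chordal       H = IsChordal H
HasClass inducedC4free H = IsC4Free H

ColoringInClass : GraphClass → ∀ {t n} → Coloring t n → Set
ColoringInClass c {t} G = ∀ (i : Fin t) → HasClass c (G i)

StrongCover : ∀ {t n} → Coloring t n → ℕ → Set
StrongCover {t} {n} G s =
  Σ (Fin s → Fin t) λ c → Σ (Fin s → Subset n) λ Q →
    Injective _≡_ _≡_ c ×
    (∀ (j : Fin s) → IsClique (G (c j)) (Q j)) ×
    (∀ (u : Fin n) → ∃ λ (j : Fin s) → u ∈ Q j)

ThetaIs : ∀ {t n} → Coloring t n → ℕ → Set
ThetaIs G s = StrongCover G s × (∀ s′ → StrongCover G s′ → s ≤ s′)

-- Projection Fin (n + p) → Fin n: old vertices stay, the p new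
-- vertices are sent to v (so the preimage of v is the clique K).
proj : ∀ {n} p → Fin n → Fin (n + p) → Fin n
proj {n} p v x with splitAt n x
... | inj₁ a = a
... | inj₂ _ = v

-- Clique substitution of v by K = {v} ∪ {p new vertices}: edges inside K
-- get all t colors, an edge between x and y with distinct projections
-- gets exactly the colors of the edge (proj x)(proj y).
substClique : ∀ {t n} → Coloring t n → (p : ℕ) → Fin n → Coloring t (n + p)
substClique G p v i x y with proj p v x ≟ proj p v y
... | yes _ = ⊤
... | no _  = G i (proj p v x) (proj p v y)

-- Substituting a clique for v blows K_n up along the projection π that collapses the
-- clique onto v: pairs inside a fibre of π get every colour, all other pairs get the
-- colours of their images. A k-set of the blow-up projects to at most k vertices, which
-- lie in a monochromatic clique of K_n whose preimage is then monochromatic, so the (t,k)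
-- property survives. Interval representations pull back along π, and an induced cycle of
-- length ≥ 4 never meets a fibre twice (two fibre-mates are adjacent twins), so it
-- projects to an induced cycle of K_n. Strong covers pull back along π and restrict along
-- the inclusion of K_n, which is a section of π, so θ is unchanged.
module Submission where

open import Defs
open import Data.Nat using (ℕ; zero; suc; _+_; _≤_; _<_; _⊓_; z≤n; s≤s; _≤?_)
open import Data.Nat.Properties
  using (≤-refl; ≤-reflexive; ≤-trans; ≤-antisym; ≰⇒>; ≤∧≢⇒<; n≤1+n; n<1+n; m⊓n≤m; m⊓n≤n; ⊓-glb)
import Data.Nat.Properties as ℕ
open import Data.Fin using (Fin; zero; suc; toℕ; fromℕ<; _↑ˡ_; splitAt; _≟_)
open import Data.Fin.Properties using (toℕ<n; toℕ-fromℕ<; splitAt-↑ˡ)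
open import Data.Fin.Subset using (Subset; _∈_; _⊆_; ∣_∣; inside; outside; ⊤; ⊥)
open import Data.Fin.Subset.Properties using (∣p∣≤n; ∣p∣≤∣x∷p∣; ∣⊥∣≡0; ∣⊤∣≡n; ⊆⊤)
open import Data.Vec using (_∷_; []; here; there; tabulate; lookup)
open import Data.Vec.Properties using (lookup∘tabulate; []=⇒lookup; lookup⇒[]=)
open import Data.Product using (∃; _×_; _,_; proj₁; proj₂)
open import Data.Sum using (_⊎_; inj₁; inj₂)
open import Data.Unit using (tt)
open import Data.Empty using (⊥-elim)
open import Function using (_∘_; id)
open import Relation.Nullary using (¬_; yes; no)
open import Relation.Binary.PropositionalEquality
  using (_≡_; _≢_; refl; sym; trans; cong; subst; subst₂; ≢-sym)

private
  variable
    t m n : ℕ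

insert : Fin n → Subset n → Subset n
insert zero    (_ ∷ p) = inside ∷ p
insert (suc x) (b ∷ p) = b ∷ insert x p

x∈insert : ∀ (x : Fin n) p → x ∈ insert x p
x∈insert zero    (_ ∷ p) = here
x∈insert (suc x) (_ ∷ p) = there (x∈insert x p)

∈-insert⁺ : ∀ (x : Fin n) p {y} → y ∈ p → y ∈ insert x p
∈-insert⁺ zero    (_ ∷ p) here      = here
∈-insert⁺ zero    (_ ∷ p) (there y) = there y
∈-insert⁺ (suc x) (_ ∷ p) here      = here
∈-insert⁺ (suc x) (_ ∷ p) (there y) = there (∈-insert⁺ x p y)

∣insert∣≤1+∣p∣ : ∀ (x : Fin n) p → ∣ insert x p ∣ ≤ suc ∣ p ∣
∣insert∣≤1+∣p∣ zero    (b       ∷ p) = s≤s (∣p∣≤∣x∷p∣ b p)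
∣insert∣≤1+∣p∣ (suc x) (inside  ∷ p) = s≤s (∣insert∣≤1+∣p∣ x p)
∣insert∣≤1+∣p∣ (suc x) (outside ∷ p) = ∣insert∣≤1+∣p∣ x p

image : (Fin m → Fin n) → Subset m → Subset n
image f []            = ⊥
image f (inside  ∷ p) = insert (f zero) (image (f ∘ suc) p)
image f (outside ∷ p) = image (f ∘ suc) p

∈-image⁺ : ∀ (f : Fin m → Fin n) p {x} → x ∈ p → f x ∈ image f p
∈-image⁺ f (inside  ∷ p) here      = x∈insert (f zero) _
∈-image⁺ f (inside  ∷ p) (there x) = ∈-insert⁺ (f zero) _ (∈-image⁺ (f ∘ suc) p x)
∈-image⁺ f (outside ∷ p) (there x) = ∈-image⁺ (f ∘ suc) p x

∣image∣≤∣p∣ : ∀ (f : Fin m → Fin n) p → ∣ image f p ∣ ≤ ∣ p ∣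
∣image∣≤∣p∣ {n = n} f [] = ≤-reflexive (∣⊥∣≡0 n)
∣image∣≤∣p∣ f (inside  ∷ p) =
  ≤-trans (∣insert∣≤1+∣p∣ (f zero) _) (s≤s (∣image∣≤∣p∣ (f ∘ suc) p))
∣image∣≤∣p∣ f (outside ∷ p) = ∣image∣≤∣p∣ (f ∘ suc) p

preimage : (Fin m → Fin n) → Subset n → Subset m
preimage f q = tabulate (lookup q ∘ f)

∈-preimage⁺ : ∀ (f : Fin m → Fin n) q {x} → f x ∈ q → x ∈ preimage f q
∈-preimage⁺ f q {x} fx∈q =
  lookup⇒[]= x (preimage f q) (trans (lookup∘tabulate (lookup q ∘ f) x) ([]=⇒lookup fx∈q))

∈-preimage⁻ : ∀ (f : Fin m → Fin n) q {x} → x ∈ preimage f q → f x ∈ q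
∈-preimage⁻ f q {x} x∈f⁻q =
  lookup⇒[]= (f x) q (trans (sym (lookup∘tabulate (lookup q ∘ f) x)) ([]=⇒lookup x∈f⁻q))

superset-of-size : (p : Subset n) (k : ℕ) → ∣ p ∣ ≤ k → k ≤ n →
                   ∃ λ q → p ⊆ q × ∣ q ∣ ≡ k
superset-of-size [] zero _ _ = [] , id , refl
superset-of-size (inside ∷ p) (suc k) (s≤s ∣p∣≤k) (s≤s k≤n)
  with superset-of-size p k ∣p∣≤k k≤n
... | q , p⊆q , ∣q∣≡k = inside ∷ q , inside∷-⊆ p⊆q , cong suc ∣q∣≡k
  where
  inside∷-⊆ : ∀ {p q : Subset n} → p ⊆ q → inside ∷ p ⊆ inside ∷ q
  inside∷-⊆ p⊆q here      = here
  inside∷-⊆ p⊆q (there x) = there (p⊆q x)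
superset-of-size {suc n} (outside ∷ p) k ∣p∣≤k k≤1+n with k ≤? n
... | no k≰n = ⊤ , ⊆⊤ , trans (∣⊤∣≡n (suc n)) (≤-antisym (≰⇒> k≰n) k≤1+n)
... | yes k≤n with superset-of-size p k ∣p∣≤k k≤n
...   | q , p⊆q , ∣q∣≡k = outside ∷ q , outside∷-⊆ p⊆q , ∣q∣≡k
  where
  outside∷-⊆ : ∀ {p q : Subset n} → p ⊆ q → outside ∷ p ⊆ outside ∷ q
  outside∷-⊆ p⊆q (there x) = there (p⊆q x)

superset-of-image : (f : Fin m → Fin n) (k : ℕ) (S : Subset m) → ∣ S ∣ ≤ k →
                    ∃ λ T → (∀ {x} → x ∈ S → f x ∈ T) × ∣ T ∣ ≡ k ⊓ n
superset-of-image {n = n} f k S ∣S∣≤k with superset-of-size (image f S) (k ⊓ n)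
  (⊓-glb (≤-trans (∣image∣≤∣p∣ f S) ∣S∣≤k) (∣p∣≤n (image f S))) (m⊓n≤n k n)
... | T , fS⊆T , ∣T∣≡k⊓n = T , (fS⊆T ∘ ∈-image⁺ f S) , ∣T∣≡k⊓n

-- CycConsec k i j unfolds to CycAdj k (toℕ i) (toℕ j).
CycAdj : ℕ → ℕ → ℕ → Set
CycAdj k i j =
  (suc i ≡ j) ⊎ (suc j ≡ i) ⊎ ((i ≡ 0 × suc j ≡ k) ⊎ (j ≡ 0 × suc i ≡ k))

private-neighbourℕ : ∀ m a b → a < 4 + m → CycAdj (4 + m) a b →
  ∃ λ z → z < 4 + m × z ≢ a × z ≢ b × CycAdj (4 + m) a z × ¬ CycAdj (4 + m) b z
private-neighbourℕ m zero .1 _ (inj₁ refl) =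
  3 + m , n<1+n _ , (λ ()) , (λ ()) , inj₂ (inj₂ (inj₁ (refl , refl))) ,
  λ { (inj₁ ()) ; (inj₂ (inj₁ ())) ; (inj₂ (inj₂ (inj₁ (() , _))))
    ; (inj₂ (inj₂ (inj₂ (() , _)))) }
private-neighbourℕ m (suc a) .(2 + a) a<k (inj₁ refl) =
  a , ≤-trans (n≤1+n _) a<k , (λ ()) , (λ ()) , inj₂ (inj₁ refl) ,
  λ { (inj₁ ()) ; (inj₂ (inj₁ ())) ; (inj₂ (inj₂ (inj₁ (() , _))))
    ; (inj₂ (inj₂ (inj₂ (refl , ())))) }
private-neighbourℕ m .(suc b) b a<k (inj₂ (inj₁ refl)) with 2 + b ℕ.≟ 4 + m
... | no 2+b≢k = 2 + b , ≤∧≢⇒< a<k 2+b≢k , (λ ()) , (λ ()) , inj₁ refl ,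
  λ { (inj₁ ()) ; (inj₂ (inj₁ ())) ; (inj₂ (inj₂ (inj₁ (refl , ()))))
    ; (inj₂ (inj₂ (inj₂ (() , _)))) }
private-neighbourℕ m .(3 + m) .(2 + m) _ (inj₂ (inj₁ refl)) | yes refl =
  0 , s≤s z≤n , (λ ()) , (λ ()) , inj₂ (inj₂ (inj₂ (refl , refl))) ,
  λ { (inj₁ ()) ; (inj₂ (inj₁ ())) ; (inj₂ (inj₂ (inj₁ (_ , ()))))
    ; (inj₂ (inj₂ (inj₂ (_ , ())))) }
private-neighbourℕ m .0 .(3 + m) _ (inj₂ (inj₂ (inj₁ (refl , refl)))) =
  1 , s≤s (s≤s z≤n) , (λ ()) , (λ ()) , inj₁ refl ,
  λ { (inj₁ ()) ; (inj₂ (inj₁ ())) ; (inj₂ (inj₂ (inj₁ (() , _))))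
    ; (inj₂ (inj₂ (inj₂ (() , _)))) }
private-neighbourℕ m .(3 + m) .0 _ (inj₂ (inj₂ (inj₂ (refl , refl)))) =
  2 + m , n≤1+n _ , (λ ()) , (λ ()) , inj₂ (inj₁ refl) ,
  λ { (inj₁ ()) ; (inj₂ (inj₁ ())) ; (inj₂ (inj₂ (inj₁ (refl , ()))))
    ; (inj₂ (inj₂ (inj₂ (() , _)))) }

private-neighbour : ∀ k → 4 ≤ k → (a b : Fin k) → CycConsec k a b →
  ∃ λ z → z ≢ a × z ≢ b × CycConsec k a z × ¬ CycConsec k b z
private-neighbour .(4 + m) (s≤s (s≤s (s≤s (s≤s {n = m} _)))) a b a~b
  with private-neighbourℕ m (toℕ a) (toℕ b) (toℕ<n a) a~b
... | z , z<k , z≢a , z≢b , a~z , b≁z =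
  fromℕ< z<k , (z≢a ∘ toℕ-fromℕ<-eq) , (z≢b ∘ toℕ-fromℕ<-eq) ,
  subst (CycAdj _ (toℕ a)) (sym (toℕ-fromℕ< z<k)) a~z ,
  b≁z ∘ subst (CycAdj _ (toℕ b)) (toℕ-fromℕ< z<k)
  where
  toℕ-fromℕ<-eq : ∀ {c} → fromℕ< z<k ≡ c → z ≡ toℕ c
  toℕ-fromℕ<-eq e = trans (sym (toℕ-fromℕ< z<k)) (cong toℕ e)

no-adjacent-twins : (H : Graph n) (k : ℕ) → 4 ≤ k → (f : Fin k → Fin n) →
  (∀ i j → i ≢ j → H (f i) (f j) ↔ CycConsec k i j) →
  ∀ a b → a ≢ b → (∀ z → H (f a) z → H (f b) z) → ¬ H (f a) (f b)
no-adjacent-twins H k 4≤k f adj a b a≢b twins fa~fb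
  with private-neighbour k 4≤k a b (proj₁ (adj a b a≢b) fa~fb)
... | z , z≢a , z≢b , a~z , b≁z =
  b≁z (proj₁ (adj b z (≢-sym z≢b)) (twins (f z) (proj₂ (adj a z (≢-sym z≢a)) a~z)))

record IsBlowUp (f : Fin m → Fin n) (G : Coloring t n) (H : Coloring t m) : Set where
  field
    complete-on-fibres : ∀ i x y → f x ≡ f y → H i x y
    inherited-across-fibres : ∀ i x y → f x ≢ f y → H i x y ↔ G i (f x) (f y)

module IsBlowUp-Properties {f : Fin m → Fin n} {G : Coloring t n} {H : Coloring t m}
                           (blowUp : IsBlowUp f G H) where
  open IsBlowUp blowUp

  edge : ∀ i x y → (f x ≢ f y → G i (f x) (f y)) → H i x y
  edge i x y across with f x ≟ f y
  ... | yes fx≡fy = complete-on-fibres i x y fx≡fy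
  ... | no fx≢fy  = proj₂ (inherited-across-fibres i x y fx≢fy) (across fx≢fy)

  fibre-twins : ∀ i {x y} → f x ≡ f y → ∀ z → H i x z → H i y z
  fibre-twins i {x} {y} fx≡fy z x~z = edge i y z λ fy≢fz →
    subst (λ w → G i w (f z)) fx≡fy
      (proj₁ (inherited-across-fibres i x z (fy≢fz ∘ trans (sym fx≡fy))) x~z)

  inducedCycle-project : ∀ i k → 4 ≤ k → InducedCycle (H i) k → InducedCycle (G i) k
  inducedCycle-project i k 4≤k (g , _ , adj) = f ∘ g , fg-injective , adj′
    where
    fg-injective : ∀ {a b} → f (g a) ≡ f (g b) → a ≡ b
    fg-injective {a} {b} fga≡fgb with a ≟ b
    ... | yes a≡b = a≡b
    ... | no a≢b  = ⊥-elim (no-adjacent-twins (H i) k 4≤k g adj a b a≢b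
                      (fibre-twins i fga≡fgb) (complete-on-fibres i _ _ fga≡fgb))
    adj′ : ∀ a b → a ≢ b → G i (f (g a)) (f (g b)) ↔ CycConsec k a b
    adj′ a b a≢b = proj₁ (adj a b a≢b) ∘ proj₂ H↔G , proj₁ H↔G ∘ proj₂ (adj a b a≢b)
      where
      H↔G = inherited-across-fibres i (g a) (g b) (a≢b ∘ fg-injective)

  isInterval : ∀ i → IsInterval (G i) → IsInterval (H i)
  isInterval i (l , r , l≤r , intersect) = l ∘ f , r ∘ f , l≤r ∘ f , intersect′
    where
    intersect′ : ∀ x y → x ≢ y → H i x y ↔ (l (f x) ≤ r (f y) × l (f y) ≤ r (f x))
    intersect′ x y _ with f x ≟ f y
    ... | yes fx≡fy = (λ _ → subst (λ w → l w ≤ r (f y)) (sym fx≡fy) (l≤r (f y)) ,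
                             subst (λ w → l (f y) ≤ r w) (sym fx≡fy) (l≤r (f y))) ,
                      (λ _ → complete-on-fibres i x y fx≡fy)
    ... | no fx≢fy  = proj₁ (intersect _ _ fx≢fy) ∘ proj₁ H↔G ,
                      proj₂ H↔G ∘ proj₂ (intersect _ _ fx≢fy)
      where
      H↔G = inherited-across-fibres i x y fx≢fy

  inClass : ∀ c → ColoringInClass c G → ColoringInClass c H
  inClass interval      G-in i = isInterval i (G-in i)
  inClass chordal       G-in i k 4≤k C = G-in i k 4≤k (inducedCycle-project i k 4≤k C)
  inClass inducedC4free G-in i C = G-in i (inducedCycle-project i 4 ≤-refl C)

  clique-pullback : ∀ i {S T} → IsClique (G i) T → (∀ {x} → x ∈ S → f x ∈ T) →
                    IsClique (H i) S
  clique-pullback i T-clique S→T x y x∈S y∈S _ =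
    edge i x y (T-clique (f x) (f y) (S→T x∈S) (S→T y∈S))

  monochromatic-pullback : ∀ k →
    (∀ T → ∣ T ∣ ≡ k ⊓ n → ∃ λ i → IsClique (G i) T) →
    ∀ S → ∣ S ∣ ≤ k → ∃ λ i → IsClique (H i) S
  monochromatic-pullback k G-mono S ∣S∣≤k with superset-of-image f k S ∣S∣≤k
  ... | T , S→T , ∣T∣≡k⊓n with G-mono T ∣T∣≡k⊓n
  ...   | i , T-clique = i , clique-pullback i T-clique S→T

  isTColoring : Fin t → IsTColoring G → IsTColoring H
  isTColoring i₀ (G-sym , G-covers) = H-sym , H-covers
    where
    H-sym : ∀ i x y → H i x y → H i y x
    H-sym i x y x~y = edge i y x λ fy≢fx →
      G-sym i (f x) (f y) (proj₁ (inherited-across-fibres i x y (≢-sym fy≢fx)) x~y)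
    H-covers : ∀ x y → x ≢ y → ∃ λ i → H i x y
    H-covers x y _ with f x ≟ f y
    ... | yes fx≡fy = i₀ , complete-on-fibres i₀ x y fx≡fy
    ... | no fx≢fy  = let i , fx~fy = G-covers (f x) (f y) fx≢fy in
                      i , proj₂ (inherited-across-fibres i x y fx≢fy) fx~fy

  isTKColoring : ∀ k → IsTKColoring k G → IsTKColoring k H
  isTKColoring k (G-col , G-mono) = isTColoring i₀ G-col , H-mono
    where
    i₀ = proj₁ (monochromatic-pullback k G-mono ⊥ (≤-trans (≤-reflexive (∣⊥∣≡0 m)) z≤n))
    H-mono : ∀ S → ∣ S ∣ ≡ k ⊓ m → ∃ λ i → IsClique (H i) S
    H-mono S ∣S∣≡k⊓m = monochromatic-pullback k G-mono S
                         (≤-trans (≤-reflexive ∣S∣≡k⊓m) (m⊓n≤m k m))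

  strongCover-pullback : ∀ {s} → StrongCover G s → StrongCover H s
  strongCover-pullback (c , Q , c-injective , Q-clique , Q-covers) =
    c , preimage f ∘ Q , c-injective ,
    (λ j → clique-pullback (c j) (Q-clique j) (∈-preimage⁻ f (Q j))) ,
    (λ x → let j , fx∈Qj = Q-covers (f x) in j , ∈-preimage⁺ f (Q j) fx∈Qj)

  module _ (g : Fin n → Fin m) (f∘g≗id : ∀ a → f (g a) ≡ a) where

    clique-restrict : ∀ i {Q} → IsClique (H i) Q → IsClique (G i) (preimage g Q)
    clique-restrict i Q-clique a b a∈ b∈ a≢b =
      subst₂ (G i) (f∘g≗id a) (f∘g≗id b)
        (proj₁ (inherited-across-fibres i (g a) (g b) fga≢fgb)
          (Q-clique (g a) (g b) (∈-preimage⁻ g _ a∈) (∈-preimage⁻ g _ b∈) (fga≢fgb ∘ cong f)))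
      where
      fga≢fgb : f (g a) ≢ f (g b)
      fga≢fgb e = a≢b (trans (sym (f∘g≗id a)) (trans e (f∘g≗id b)))

    strongCover-restrict : ∀ {s} → StrongCover H s → StrongCover G s
    strongCover-restrict (c , Q , c-injective , Q-clique , Q-covers) =
      c , preimage g ∘ Q , c-injective ,
      (λ j → clique-restrict (c j) (Q-clique j)) ,
      (λ a → let j , ga∈Qj = Q-covers (g a) in j , ∈-preimage⁺ g (Q j) ga∈Qj)

    thetaIs : ∀ {s} → ThetaIs G s → ThetaIs H s
    thetaIs (cover , minimal) =
      strongCover-pullback cover , λ s′ → minimal s′ ∘ strongCover-restrict

proj-↑ˡ : ∀ p (v : Fin n) a → proj p v (a ↑ˡ p) ≡ a
proj-↑ˡ {n} p v a with splitAt n (a ↑ˡ p) | splitAt-↑ˡ n a p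
... | .(inj₁ a) | refl = refl

substClique-isBlowUp : (G : Coloring t n) (p : ℕ) (v : Fin n) →
                       IsBlowUp (proj p v) G (substClique G p v)
substClique-isBlowUp G p v = record
  { complete-on-fibres = complete
  ; inherited-across-fibres = inherited
  }
  where
  complete : ∀ i x y → proj p v x ≡ proj p v y → substClique G p v i x y
  complete i x y πx≡πy with proj p v x ≟ proj p v y
  ... | yes _     = tt
  ... | no πx≢πy  = ⊥-elim (πx≢πy πx≡πy)
  inherited : ∀ i x y → proj p v x ≢ proj p v y →
              substClique G p v i x y ↔ G i (proj p v x) (proj p v y)
  inherited i x y πx≢πy with proj p v x ≟ proj p v y
  ... | yes πx≡πy = ⊥-elim (πx≢πy πx≡πy)
  ... | no _      = id , id

proposition1p4 : (c : GraphClass) (t k n s : ℕ) (G : Coloring t n) →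
    IsTKColoring k G → ColoringInClass c G → ThetaIs G s →
    (p : ℕ) (v : Fin n) →
    IsTKColoring k (substClique G p v) ×
    ColoringInClass c (substClique G p v) ×
    ThetaIs (substClique G p v) s
proposition1p4 c t k n s G G-tk G-in θG=s p v =
  isTKColoring k G-tk , inClass c G-in , thetaIs (_↑ˡ p) (proj-↑ˡ p v) θG=s
  where
  open IsBlowUp-Properties (substClique-isBlowUp G p v)
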